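{- The map $r:\mathcal D_{n,m,\sigma}\to\mathcal R_{n,m,\sigma}$ is surjective.
   Context: For a positive integer $k$, $[k]=\{1,\dots,k\}$. A DFA is a triple $D=(Q,\Sigma,\delta)$ with $Q=[n]$, source state $1$, alphabet $\Sigma=[\sigma]$ ordered as integers, and partial transition function $\delta:Q\times\Sigma\to Q$; $m$ is the number of pairs on which $\delta$ is defined. DFAs are assumed to satisfy: state $v$ has an incoming transition iff $v>1$. A WDFA (w.r.t. order $1<\dots<n$) satisfies: (i) if $u'=\delta(u,a)$, $v'=\delta(v,a')$ and $a<a'$ then $u'<v'$; (ii) if $u'=\delta(u,a)\ne\delta(v,a)=v'$ and $u<v$ then $u'<v'$. $\mathcal D_{n,m,\sigma}$ is the set of WDFAs with states $[n]$, $m$ transitions, effective alphabet $[\sigma]$ (every letter labels some transition), and Wheeler order $1<\dots<n$. Standing assumptions: $n-1\le m\le n\sigma$, $\sigma\le n-1$. For a 0/1 vector $x$, $\|x\|$ is its number of ones; for a 0/1 matrix $A$, $A_j$ is its $j$-th column and $\|A\|$ its number of ones. Let $\mathcal O_{n,\sigma,m}=\{O\in\{0,1\}^{n\times\sigma}:\|O\|=m,\ \|O_j\|\ge1\ \forall j\in[\sigma]\}$, $\mathcal I_{m,n}=\{I\in\{0,1\}^m:\|I\|=n-1\}$, for $O\in\mathcal O_{n,\sigma,m}$ let $\mathcal I_O=\{I\in\mathcal I_{m,n}: I_{1+\sum_{k=1}^{j-1}\|O_k\|}=1\ \forall j\in[\sigma]\}$, and $\mathcal R_{n,m,\sigma}=\{(O,I):O\in\mathcal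 O_{n,\sigma,m},\ I\in\mathcal I_O\}$. For $D\in\mathcal D_{n,m,\sigma}$, $r(D)=(O,I)$ where $O_{u,j}=1$ iff $\delta(u,j)$ is defined, and $I$ is the concatenation over $v=2,\dots,n$ (in order) of a single $1$ followed by $|\delta^{in}(v)|-1$ zeros, where $\delta^{in}(v)=\{u:\exists j,\ \delta(u,j)=v\}$. (By the preceding result of the paper, $r(D)\in\mathcal R_{n,m,\sigma}$ for all $D\in\mathcal D_{n,m,\sigma}$.) -}

module Defs where

open import Data.Nat using (ℕ; zero; suc; _+_; _∸_; _<_; _≤_; _<ᵇ_)
open import Data.Fin using (Fin; zero; suc; toℕ; fromℕ<) renaming (_<_ to _<ᶠ_)
open import Data.Fin.Properties using () renaming (_≟_ to _≟ᶠ_)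
open import Data.Bool using (Bool; true; false; if_then_else_; _∨_)
open import Data.Maybe using (Maybe; just; nothing; is-just)
open import Data.List using (List; []; _∷_; replicate; concatMap; allFin)
open import Data.Vec using (Vec; lookup)
open import Data.Product using (_×_; ∃; ∃₂; Σ)
open import Relation.Binary.PropositionalEquality using (_≡_; _≢_)
open import Relation.Nullary using (does)

-- Conventions: state u ∈ [n] is represented by (u-1) : Fin n, so the source
-- state 1 is the Fin element with toℕ = 0; letter j ∈ [σ] by (j-1) : Fin σ.

sumFin : ∀ {k} → (Fin k → ℕ) → ℕ
sumFin {zero} f = 0
sumFin {suc k} f = f zero + sumFin (λ i → f (suc i))

b2n : Bool → ℕ
b2n true = 1
b2n false = 0

count : ∀ {k} → (Fin k → Bool) → ℕ
count p = sumFin (λ i → b2n (p i))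

anyFin : ∀ {k} → (Fin k → Bool) → Bool
anyFin {zero} p = false
anyFin {suc k} p = p zero ∨ anyFin (λ i → p (suc i))

Trans : ℕ → ℕ → Set
Trans n σ = Fin n → Fin σ → Maybe (Fin n)

numTrans : ∀ {n σ} → Trans n σ → ℕ
numTrans δ = sumFin (λ u → count (λ j → is-just (δ u j)))

HasIncoming : ∀ {n σ} → Trans n σ → Fin n → Set
HasIncoming δ v = ∃₂ λ u a → δ u a ≡ just v

record InD (n m σ : ℕ) (δ : Trans n σ) : Set where
  field
    incoming⇒nonsource : ∀ v → HasIncoming δ v → 0 < toℕ v
    nonsource⇒incoming : ∀ v → 0 < toℕ v → HasIncoming δ v
    wheeler-i  : ∀ {u v u' v' : Fin n} {a a' : Fin σ} →
                 δ u a ≡ just u' → δ v a' ≡ just v' → a <ᶠ a' → u' <ᶠ v'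
    wheeler-ii : ∀ {u v u' v' : Fin n} {a : Fin σ} →
                 δ u a ≡ just u' → δ v a ≡ just v' → u' ≢ v' → u <ᶠ v → u' <ᶠ v'
    numTrans≡m : numTrans δ ≡ m
    effective  : ∀ (j : Fin σ) → ∃₂ λ u v → δ u j ≡ just v

matchB : ∀ {n} → Maybe (Fin n) → Fin n → Bool
matchB nothing v = false
matchB (just w) v = does (w ≟ᶠ v)

indeg : ∀ {n σ} → Trans n σ → Fin n → ℕ
indeg δ v = count (λ u → anyFin (λ j → matchB (δ u j) v))

rO : ∀ {n σ} → Trans n σ → Fin n → Fin σ → Bool
rO δ u j = is-just (δ u j)

block : ∀ {n σ} → Trans n σ → Fin n → List Bool
block δ v = true ∷ replicate (indeg δ v ∸ 1) false

rI : ∀ {n σ} → Trans n σ → List Bool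
rI {zero} δ = []
rI {suc k} δ = concatMap (λ w → block δ (suc w)) (allFin k)

Matrix : ℕ → ℕ → Set
Matrix n σ = Fin n → Fin σ → Bool

matOnes : ∀ {n σ} → Matrix n σ → ℕ
matOnes O = sumFin (λ u → count (λ j → O u j))

colOnes : ∀ {n σ} → Matrix n σ → Fin σ → ℕ
colOnes O j = count (λ u → O u j)

colPrefix : ∀ {n σ} → Matrix n σ → Fin σ → ℕ
colPrefix O j = sumFin (λ k → if toℕ k <ᵇ toℕ j then colOnes O k else 0)

InO : (n σ m : ℕ) → Matrix n σ → Set
InO n σ m O = (matOnes O ≡ m) × (∀ (j : Fin σ) → 1 ≤ colOnes O j)

InI : (m n : ℕ) → Vec Bool m → Set
InI m n I = count (lookup I) ≡ n ∸ 1

-- I ∈ ℐ_O, given I ∈ ℐ_{m,n}: the entry at 1-based position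
-- 1 + Σ_{k<j} ‖O_k‖ (0-based position colPrefix O j) exists and equals 1
InIO : ∀ {n σ m} → Matrix n σ → Vec Bool m → Set
InIO {n} {σ} {m} O I =
  ∀ (j : Fin σ) → Σ (colPrefix O j < m) (λ p → lookup I (fromℕ< p) ≡ true)

InR : (n m σ : ℕ) → Matrix n σ → Vec Bool m → Set
InR n m σ O I = InO n σ m O × InI m n I × InIO O I

module Submission where

open import Defs
open import Data.Nat using (ℕ; zero; suc; _+_; _≤_; _<_; _∸_; _*_; z≤n; s≤s; _≡ᵇ_)
open import Data.Nat.Properties
open import Algebra.Properties.CommutativeMonoid.Sum +-0-commutativeMonoid using (sum; ∑-comm)
open import Data.Fin using (Fin; zero; suc; toℕ; fromℕ<) renaming (_<_ to _<ᶠ_)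
open import Data.Fin.Properties using (toℕ-injective; toℕ<n; toℕ-fromℕ<; fromℕ<-cong) renaming (_≟_ to _≟ᶠ_)
open import Data.Bool using (Bool; true; false; _∧_; _∨_; T)
open import Data.Maybe using (Maybe; just; nothing)
open import Data.List using (List; []; _∷_; _++_; replicate; concat; applyUpTo; tabulate)
open import Data.List.Properties using (map-tabulate)
open import Data.Vec using (Vec; toList; lookup; []; _∷_)
open import Data.Product using (_×_; ∃; _,_; proj₂)
open import Data.Empty using (⊥; ⊥-elim)
open import Function using (_∘_; flip; id)
open import Relation.Binary.PropositionalEquality
open import Relation.Nullary using (does; yes)

-- List the transitions (u, j) with O u j = 1 column by column and, inside a
-- column, by increasing u, and identify them with the positions 0, …, m-1 of I.
-- Send the transition at position p to state 1 + (number of ones of I among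
-- positions 0, …, p).  Targets then increase weakly with the source inside a
-- column and strictly across columns, because every column starts at a one of
-- I: this is the Wheeler property.  The positions sent to the state of the v-th
-- one of I form the block of I from that one up to the next, so the in-degree
-- of that state is the length of the block, which is exactly what r records.

sumFin-cong : ∀ {k} {f g : Fin k → ℕ} → (∀ i → f i ≡ g i) → sumFin f ≡ sumFin g
sumFin-cong {zero}  f≗g = refl
sumFin-cong {suc k} f≗g = cong₂ _+_ (f≗g zero) (sumFin-cong (f≗g ∘ suc))

sumFin-zero : ∀ k → sumFin {k} (λ _ → 0) ≡ 0
sumFin-zero zero    = refl
sumFin-zero (suc k) = sumFin-zero k

sumFin≡sum : ∀ {k} (f : Fin k → ℕ) → sumFin f ≡ sum f
sumFin≡sum {zero}  f = refl
sumFin≡sum {suc k} f = cong (f zero +_) (sumFin≡sum (f ∘ suc))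

sumFin²≡sum² : ∀ {a b} (f : Fin a → Fin b → ℕ) →
               sumFin (λ u → sumFin (f u)) ≡ sum (λ u → sum (f u))
sumFin²≡sum² f = trans (sumFin-cong (sumFin≡sum ∘ f)) (sumFin≡sum (λ u → sum (f u)))

sumFin-comm : ∀ {a b} (f : Fin a → Fin b → ℕ) →
              sumFin (λ u → sumFin (f u)) ≡ sumFin (λ j → sumFin (λ u → f u j))
sumFin-comm f = trans (sumFin²≡sum² f) (trans (∑-comm f) (sym (sumFin²≡sum² (flip f))))

count-cong : ∀ {k} {f g : Fin k → Bool} → (∀ i → f i ≡ g i) → count f ≡ count g
count-cong f≗g = sumFin-cong (cong b2n ∘ f≗g)

anyFin-cong : ∀ {k} {f g : Fin k → Bool} → (∀ i → f i ≡ g i) → anyFin f ≡ anyFin g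
anyFin-cong {zero}  f≗g = refl
anyFin-cong {suc k} f≗g = cong₂ _∨_ (f≗g zero) (anyFin-cong (f≗g ∘ suc))

count-witness : ∀ {k} (f : Fin k → Bool) → 1 ≤ count f → ∃ λ i → f i ≡ true
count-witness {suc k} f pos with f zero in eq
... | true  = zero , eq
... | false with count-witness (f ∘ suc) pos
...   | i , fi = suc i , fi

anyFin-witness : ∀ {k} (f : Fin k → Bool) → anyFin f ≡ true → ∃ λ i → f i ≡ true
anyFin-witness {suc k} f any with f zero in eq
... | true  = zero , eq
... | false with anyFin-witness (f ∘ suc) any
...   | i , fi = suc i , fi

AtMostOne : ∀ {k} → (Fin k → Bool) → Set
AtMostOne f = ∀ {i j} → f i ≡ true → f j ≡ true → i <ᶠ j → ⊥

b2n-anyFin : ∀ {k} (f : Fin k → Bool) → AtMostOne f → b2n (anyFin f) ≡ count f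
b2n-anyFin {zero}  f amo = refl
b2n-anyFin {suc k} f amo with f zero in eq
... | true  = cong suc (sym (trans (count-cong tail-false) (sumFin-zero k)))
  where
  tail-false : ∀ i → f (suc i) ≡ false
  tail-false i with f (suc i) in e
  ... | true  = ⊥-elim (amo eq e (s≤s z≤n))
  ... | false = refl
... | false = b2n-anyFin (f ∘ suc) (λ fi fj i<j → amo fi fj (s≤s i<j))

∧-true : ∀ {a b} → a ∧ b ≡ true → a ≡ true × b ≡ true
∧-true {true} b≡true = refl , b≡true

≡ᵇ-true⇒≡ : ∀ {m n} → (m ≡ᵇ n) ≡ true → m ≡ n
≡ᵇ-true⇒≡ {m} {n} eq = ≡ᵇ⇒≡ m n (subst T (sym eq) _)

does-≟ᶠ : ∀ {n} (a b : Fin n) → does (a ≟ᶠ b) ≡ (toℕ a ≡ᵇ toℕ b)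
does-≟ᶠ zero    zero    = refl
does-≟ᶠ zero    (suc b) = refl
does-≟ᶠ (suc a) zero    = refl
does-≟ᶠ (suc a) (suc b) = does-≟ᶠ a b

matchB-true : ∀ {n} (x : Maybe (Fin n)) v → matchB x v ≡ true → x ≡ just v
matchB-true (just w) v eq with w ≟ᶠ v
... | yes refl = refl

countBelow : ℕ → (ℕ → Bool) → ℕ
countBelow zero    P = 0
countBelow (suc c) P = b2n (P 0) + countBelow c (P ∘ suc)

countBelow-cong : ∀ c {P Q : ℕ → Bool} → (∀ p → P p ≡ Q p) → countBelow c P ≡ countBelow c Q
countBelow-cong zero    P≗Q = refl
countBelow-cong (suc c) P≗Q = cong₂ _+_ (cong b2n (P≗Q 0)) (countBelow-cong c (P≗Q ∘ suc))

countBelow-false : ∀ c → countBelow c (λ _ → false) ≡ 0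
countBelow-false zero    = refl
countBelow-false (suc c) = countBelow-false c

countBelow-+ : ∀ a b P → countBelow a P + countBelow b (λ p → P (a + p)) ≡ countBelow (a + b) P
countBelow-+ zero    b P = refl
countBelow-+ (suc a) b P =
  trans (+-assoc (b2n (P 0)) _ _) (cong (b2n (P 0) +_) (countBelow-+ a b (P ∘ suc)))

rank : ∀ {k} → (Fin k → Bool) → Fin k → ℕ
rank f zero    = 0
rank f (suc i) = b2n (f zero) + rank (f ∘ suc) i

count-∧-rank : ∀ {k} (f : Fin k → Bool) (P : ℕ → Bool) →
               count (λ i → f i ∧ P (rank f i)) ≡ countBelow (count f) P
count-∧-rank {zero}  f P = refl
count-∧-rank {suc k} f P with f zero
... | true  = cong (b2n (P 0) +_) (count-∧-rank (f ∘ suc) (P ∘ suc))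
... | false = count-∧-rank (f ∘ suc) P

rank<count : ∀ {k} (f : Fin k → Bool) u → f u ≡ true → rank f u < count f
rank<count f zero    fu rewrite fu = s≤s z≤n
rank<count f (suc u) fu = +-monoʳ-< (b2n (f zero)) (rank<count (f ∘ suc) u fu)

rank-mono-< : ∀ {k} (f : Fin k → Bool) {u v} → u <ᶠ v → f u ≡ true → rank f u < rank f v
rank-mono-< f {zero}  {suc v} u<v       fu rewrite fu = s≤s z≤n
rank-mono-< f {suc u} {suc v} (s≤s u<v) fu = +-monoʳ-< (b2n (f zero)) (rank-mono-< (f ∘ suc) u<v fu)

prefixOnes : ∀ {m} → Vec Bool m → ℕ → ℕ
prefixOnes []       p       = 0
prefixOnes (x ∷ xs) zero    = b2n x
prefixOnes (x ∷ xs) (suc p) = b2n x + prefixOnes xs p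

prefixOnes-mono : ∀ {m} (I : Vec Bool m) {p q} → p ≤ q → prefixOnes I p ≤ prefixOnes I q
prefixOnes-mono []       _                 = z≤n
prefixOnes-mono (x ∷ xs) {zero}  {zero}  _ = ≤-refl
prefixOnes-mono (x ∷ xs) {zero}  {suc q} _ = m≤m+n (b2n x) _
prefixOnes-mono (x ∷ xs) {suc p} {suc q} (s≤s p≤q) = +-monoʳ-≤ (b2n x) (prefixOnes-mono xs p≤q)

prefixOnes≤count : ∀ {m} (I : Vec Bool m) p → prefixOnes I p ≤ count (lookup I)
prefixOnes≤count []       p       = z≤n
prefixOnes≤count (x ∷ xs) zero    = m≤m+n _ _
prefixOnes≤count (x ∷ xs) (suc p) = +-monoʳ-≤ (b2n x) (prefixOnes≤count xs p)

prefixOnes-pos : ∀ {m} (I : Vec Bool m) q (q<m : q < m) → lookup I (fromℕ< q<m) ≡ true →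
                 1 ≤ prefixOnes I q
prefixOnes-pos (x ∷ xs) zero    _         Iq rewrite Iq = ≤-refl
prefixOnes-pos (x ∷ xs) (suc q) (s≤s q<m) Iq = ≤-trans (prefixOnes-pos xs q q<m Iq) (m≤n+m _ (b2n x))

prefixOnes-strict : ∀ {m} (I : Vec Bool m) {p} q → p < q → (q<m : q < m) →
                    lookup I (fromℕ< q<m) ≡ true → prefixOnes I p < prefixOnes I q
prefixOnes-strict (true  ∷ xs) {zero}  (suc q) _         (s≤s q<m) Iq = s≤s (prefixOnes-pos xs q q<m Iq)
prefixOnes-strict (false ∷ xs) {zero}  (suc q) _         (s≤s q<m) Iq = prefixOnes-pos xs q q<m Iq
prefixOnes-strict (x ∷ xs)     {suc p} (suc q) (s≤s p<q) (s≤s q<m) Iq =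
  +-monoʳ-< (b2n x) (prefixOnes-strict xs q p<q q<m Iq)

-- fiber I v: the number of positions p < m with prefixOnes I p = v, which for
-- v ≥ 1 is the length of the block of I starting at its v-th one.
fiber : ∀ {m} → Vec Bool m → ℕ → ℕ
fiber {m} I v = countBelow m (λ p → prefixOnes I p ≡ᵇ v)

fiber-nonempty : ∀ {m} (I : Vec Bool m) v → 1 ≤ v → v ≤ count (lookup I) → 1 ≤ fiber I v
fiber-nonempty []           zero          ()  _
fiber-nonempty []           (suc v)       _   ()
fiber-nonempty (false ∷ xs) v             1≤v v≤c = ≤-trans (fiber-nonempty xs v 1≤v v≤c) (m≤n+m _ _)
fiber-nonempty (true  ∷ xs) 1             _   _   = s≤s z≤n
fiber-nonempty (true  ∷ xs) (suc (suc v)) _   (s≤s v≤c) =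
  ≤-trans (fiber-nonempty xs (suc v) (s≤s z≤n) v≤c) (m≤n+m _ _)

fiber-zero : ∀ {m} (I : Vec Bool m) → (∀ (0<m : 0 < m) → lookup I (fromℕ< 0<m) ≡ true) →
             fiber I 0 ≡ 0
fiber-zero []                 _     = refl
fiber-zero {suc m} (x ∷ xs) firstOne with firstOne (s≤s z≤n)
... | refl = countBelow-false m

oneBlock : ℕ → List Bool
oneBlock len = true ∷ replicate (len ∸ 1) false

blocks≡toList : ∀ {m} (I : Vec Bool m) →
                replicate (fiber I 0) false ++
                concat (applyUpTo (oneBlock ∘ fiber I ∘ suc) (count (lookup I))) ≡ toList I
blocks≡toList []           = refl
blocks≡toList (false ∷ xs) = cong (false ∷_) (blocks≡toList xs)
blocks≡toList {suc m} (true ∷ xs) =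
  trans (cong (λ z → replicate z false ++ blocks) (countBelow-false m))
        (cong (true ∷_) (blocks≡toList xs))
  where blocks = concat (applyUpTo (oneBlock ∘ fiber (true ∷ xs) ∘ suc) (suc (count (lookup xs))))

tabulate≡applyUpTo : ∀ {A : Set} {k} {f : Fin k → A} {g : ℕ → A} →
                     (∀ i → f i ≡ g (toℕ i)) → tabulate f ≡ applyUpTo g k
tabulate≡applyUpTo {k = zero}  f≗g = refl
tabulate≡applyUpTo {k = suc k} f≗g = cong₂ _∷_ (f≗g zero) (tabulate≡applyUpTo (f≗g ∘ suc))

colPrefix-zero : ∀ {n σ} (O : Matrix n (suc σ)) → colPrefix O zero ≡ 0
colPrefix-zero {σ = σ} O = sumFin-zero (suc σ)

colPrefix+colOnes≤colPrefix : ∀ {n σ} (O : Matrix n σ) {a a′} → a <ᶠ a′ →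
                              colPrefix O a + colOnes O a ≤ colPrefix O a′
colPrefix+colOnes≤colPrefix O {zero} {suc a′} _ rewrite colPrefix-zero O = m≤m+n _ _
colPrefix+colOnes≤colPrefix O {suc a} {suc a′} (s≤s a<a′) =
  ≤-trans (≤-reflexive (+-assoc (colOnes O zero) _ _))
          (+-monoʳ-≤ (colOnes O zero) (colPrefix+colOnes≤colPrefix (λ u j → O u (suc j)) a<a′))

-- Column 0 starts at position 0, so I begins with a one.
InIO⇒firstOne : ∀ {n σ m} (O : Matrix n σ) (I : Vec Bool m) → matOnes O ≡ m → InIO O I →
                (0<m : 0 < m) → lookup I (fromℕ< 0<m) ≡ true
InIO⇒firstOne {n} {zero} O I ones≡m _ 0<m
  with () ← <-irrefl (trans (sym (sumFin-zero n)) ones≡m) 0<m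
InIO⇒firstOne {σ = suc σ} O I _ columnStarts 0<m with columnStarts zero
... | start<m , Istart =
  trans (cong (lookup I) (fromℕ<-cong 0 (colPrefix O zero) (sym (colPrefix-zero O)) 0<m start<m)) Istart

-- Column j of O occupies the positions colPrefix O j + r, r < colOnes O j.
sum-countBelow-columns : ∀ {n σ} (O : Matrix n σ) (P : ℕ → Bool) →
  sumFin (λ j → countBelow (colOnes O j) (λ r → P (colPrefix O j + r))) ≡
  countBelow (sumFin (colOnes O)) P
sum-countBelow-columns {σ = zero}  O P = refl
sum-countBelow-columns {σ = suc σ} O P = begin
  countBelow c₀ (λ r → P (colPrefix O zero + r)) +
  sumFin (λ j → countBelow (colOnes O′ j) (λ r → P ((c₀ + colPrefix O′ j) + r)))
    ≡⟨ cong₂ _+_ (countBelow-cong c₀ (λ r → cong (λ z → P (z + r)) (colPrefix-zero O)))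
                 (sumFin-cong (λ j → countBelow-cong (colOnes O′ j) (λ r → cong P (+-assoc c₀ (colPrefix O′ j) r)))) ⟩
  countBelow c₀ P + sumFin (λ j → countBelow (colOnes O′ j) (λ r → P (c₀ + (colPrefix O′ j + r))))
    ≡⟨ cong (countBelow c₀ P +_) (sum-countBelow-columns O′ (λ p → P (c₀ + p))) ⟩
  countBelow c₀ P + countBelow (sumFin (colOnes O′)) (λ p → P (c₀ + p))
    ≡⟨ countBelow-+ c₀ _ P ⟩
  countBelow (c₀ + sumFin (colOnes O′)) P ∎
  where
  open ≡-Reasoning
  c₀ = colOnes O zero
  O′ = λ u j → O u (suc j)

module Realisation (k m σ : ℕ) (O : Matrix (suc k) σ) (I : Vec Bool m)
                   (ones≡m : matOnes O ≡ m) (colsNonEmpty : ∀ j → 1 ≤ colOnes O j)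
                   (onesI≡k : count (lookup I) ≡ k) (columnStarts : InIO O I) where

  column : Fin σ → Fin (suc k) → Bool
  column j u = O u j

  position : Fin (suc k) → Fin σ → ℕ
  position u j = colPrefix O j + rank (column j) u

  target : Fin (suc k) → Fin σ → Fin (suc k)
  target u j = fromℕ< (s≤s (subst (prefixOnes I (position u j) ≤_) onesI≡k (prefixOnes≤count I _)))

  toℕ-target : ∀ u j → toℕ (target u j) ≡ prefixOnes I (position u j)
  toℕ-target u j = toℕ-fromℕ< _

  δ : Trans (suc k) σ
  δ u j with O u j
  ... | true  = just (target u j)
  ... | false = nothing

  δ-just : ∀ {u j} → O u j ≡ true → δ u j ≡ just (target u j)
  δ-just {u} {j} Ouj rewrite Ouj = refl

  δ-inv : ∀ {u j w} → δ u j ≡ just w → O u j ≡ true × toℕ w ≡ prefixOnes I (position u j)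
  δ-inv {u} {j} eq with O u j | eq
  ... | true | refl = refl , toℕ-target u j

  rO≡O : ∀ u j → rO δ u j ≡ O u j
  rO≡O u j with O u j
  ... | true  = refl
  ... | false = refl

  position<colPrefix : ∀ {u a a′} → O u a ≡ true → a <ᶠ a′ → position u a < colPrefix O a′
  position<colPrefix {u} {a} Oua a<a′ =
    <-≤-trans (+-monoʳ-< (colPrefix O a) (rank<count (column a) u Oua))
              (colPrefix+colOnes≤colPrefix O a<a′)

  -- Column a′ begins at a one of I, so the count of ones strictly increases there.
  target-<-across : ∀ {u v a a′} → O u a ≡ true → a <ᶠ a′ →
                    prefixOnes I (position u a) < prefixOnes I (position v a′)
  target-<-across {u} {v} {a} {a′} Oua a<a′ with columnStarts a′
  ... | start<m , Istart =
    <-≤-trans (prefixOnes-strict I (colPrefix O a′) (position<colPrefix Oua a<a′) start<m Istart)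
              (prefixOnes-mono I (m≤m+n (colPrefix O a′) (rank (column a′) v)))

  target-≤-within : ∀ {u v a} → O u a ≡ true → u <ᶠ v →
                    prefixOnes I (position u a) ≤ prefixOnes I (position v a)
  target-≤-within {u} {v} {a} Oua u<v =
    prefixOnes-mono I (+-monoʳ-≤ (colPrefix O a) (<⇒≤ (rank-mono-< (column a) u<v Oua)))

  target-pos : ∀ u a → 1 ≤ prefixOnes I (position u a)
  target-pos u a with columnStarts a
  ... | start<m , Istart = ≤-trans (prefixOnes-pos I (colPrefix O a) start<m Istart)
                                   (prefixOnes-mono I (m≤m+n (colPrefix O a) _))

  enters : Fin (suc k) → Fin (suc k) → Fin σ → Bool
  enters v u j = O u j ∧ (prefixOnes I (position u j) ≡ᵇ toℕ v)

  matchB≡enters : ∀ u j v → matchB (δ u j) v ≡ enters v u j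
  matchB≡enters u j v with O u j
  ... | false = refl
  ... | true  = trans (does-≟ᶠ (target u j) v) (cong (_≡ᵇ toℕ v) (toℕ-target u j))

  enters-atMostOne : ∀ v u → AtMostOne (enters v u)
  enters-atMostOne v u {i} {j} ei ej i<j with ∧-true {O u i} ei | ∧-true {O u j} ej
  ... | Oui , ti | _ , tj =
    <-irrefl (trans (≡ᵇ-true⇒≡ ti) (sym (≡ᵇ-true⇒≡ tj))) (target-<-across {u} {u} Oui i<j)

  sum-colOnes≡m : sumFin (colOnes O) ≡ m
  sum-colOnes≡m = trans (sym (sumFin-comm (λ u j → b2n (O u j)))) ones≡m

  -- indeg counts sources, and by Wheeler (i) a source has at most one transition into v.
  indeg≡fiber : ∀ v → indeg δ v ≡ fiber I (toℕ v)
  indeg≡fiber v = begin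
    indeg δ v
      ≡⟨ sumFin-cong (λ u → trans (cong b2n (anyFin-cong (λ j → matchB≡enters u j v)))
                                  (b2n-anyFin (enters v u) (enters-atMostOne v u))) ⟩
    sumFin (λ u → count (λ j → O u j ∧ P (position u j)))
      ≡⟨ sumFin-comm (λ u j → b2n (O u j ∧ P (position u j))) ⟩
    sumFin (λ j → count (λ u → O u j ∧ P (position u j)))
      ≡⟨ sumFin-cong (λ j → count-∧-rank (column j) (λ r → P (colPrefix O j + r))) ⟩
    sumFin (λ j → countBelow (colOnes O j) (λ r → P (colPrefix O j + r)))
      ≡⟨ sum-countBelow-columns O P ⟩
    countBelow (sumFin (colOnes O)) P
      ≡⟨ cong (λ c → countBelow c P) sum-colOnes≡m ⟩
    fiber I (toℕ v) ∎
    where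
    open ≡-Reasoning
    P : ℕ → Bool
    P p = prefixOnes I p ≡ᵇ toℕ v

  wheeler-i : ∀ {u v u′ v′ a a′} → δ u a ≡ just u′ → δ v a′ ≡ just v′ → a <ᶠ a′ → u′ <ᶠ v′
  wheeler-i {u} {v} eq eq′ a<a′ with δ-inv eq | δ-inv eq′
  ... | Oua , u′≡ | _ , v′≡ = subst₂ _<_ (sym u′≡) (sym v′≡) (target-<-across {u} {v} Oua a<a′)

  wheeler-ii : ∀ {u v u′ v′ a} → δ u a ≡ just u′ → δ v a ≡ just v′ → u′ ≢ v′ → u <ᶠ v → u′ <ᶠ v′
  wheeler-ii eq eq′ u′≢v′ u<v with δ-inv eq | δ-inv eq′
  ... | Oua , u′≡ | _ , v′≡ =
    ≤∧≢⇒< (subst₂ _≤_ (sym u′≡) (sym v′≡) (target-≤-within Oua u<v)) (u′≢v′ ∘ toℕ-injective)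

  incoming⇒nonsource : ∀ v → HasIncoming δ v → 0 < toℕ v
  incoming⇒nonsource v (u , a , eq) = subst (1 ≤_) (sym (proj₂ (δ-inv eq))) (target-pos u a)

  nonsource⇒incoming : ∀ v → 0 < toℕ v → HasIncoming δ v
  nonsource⇒incoming v 0<v =
    let (u , u↦v) = count-witness (λ u → anyFin (λ j → matchB (δ u j) v)) indeg≥1
        (j , uj↦v) = anyFin-witness (λ j → matchB (δ u j) v) u↦v
    in u , j , matchB-true (δ u j) v uj↦v
    where
    indeg≥1 : 1 ≤ indeg δ v
    indeg≥1 = subst (1 ≤_) (sym (indeg≡fiber v))
                (fiber-nonempty I (toℕ v) 0<v (subst (toℕ v ≤_) (sym onesI≡k) (≤-pred (toℕ<n v))))

  inD : InD (suc k) m σ δ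
  inD = record
    { incoming⇒nonsource = incoming⇒nonsource
    ; nonsource⇒incoming = nonsource⇒incoming
    ; wheeler-i  = wheeler-i
    ; wheeler-ii = wheeler-ii
    ; numTrans≡m = trans (sumFin-cong (λ u → count-cong (rO≡O u))) ones≡m
    ; effective  = λ j → let (u , Ouj) = count-witness (column j) (colsNonEmpty j)
                         in u , target u j , δ-just Ouj
    }

  rI≡I : rI δ ≡ toList I
  rI≡I = begin
    rI δ
      ≡⟨ cong concat (map-tabulate id (λ w → block δ (suc w))) ⟩
    concat (tabulate (λ w → block δ (suc w)))
      ≡⟨ cong concat (tabulate≡applyUpTo (λ w → cong oneBlock (indeg≡fiber (suc w)))) ⟩
    concat (applyUpTo (oneBlock ∘ fiber I ∘ suc) k)
      ≡⟨ cong (concat ∘ applyUpTo (oneBlock ∘ fiber I ∘ suc)) (sym onesI≡k) ⟩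
    replicate 0 false ++ concat (applyUpTo (oneBlock ∘ fiber I ∘ suc) (count (lookup I)))
      ≡⟨ cong (λ c → replicate c false ++ blocks) (sym (fiber-zero I (InIO⇒firstOne O I ones≡m columnStarts))) ⟩
    replicate (fiber I 0) false ++ concat (applyUpTo (oneBlock ∘ fiber I ∘ suc) (count (lookup I)))
      ≡⟨ blocks≡toList I ⟩
    toList I ∎
    where
    open ≡-Reasoning
    blocks = concat (applyUpTo (oneBlock ∘ fiber I ∘ suc) (count (lookup I)))

lemma13 : (n m σ : ℕ) → 1 ≤ n → n ∸ 1 ≤ m → m ≤ n * σ → σ ≤ n ∸ 1 →
          (O : Matrix n σ) (I : Vec Bool m) → InR n m σ O I →
          ∃ λ (δ : Trans n σ) →
            InD n m σ δ × (∀ u j → rO δ u j ≡ O u j) × (rI δ ≡ toList I)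
lemma13 (suc k) m σ _ _ _ _ O I ((ones≡m , colsNonEmpty) , onesI≡k , columnStarts) =
  δ , inD , rO≡O , rI≡I
  where open Realisation k m σ O I ones≡m colsNonEmpty onesI≡k columnStarts
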